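{- Let $\mathbb P$ be a large-tree forcing notion, $\langle T,T'\rangle\in\mathbb P\times_{\mathsf E_0}\mathbb P$, $n<\omega$ and $s,t\in 2^n$. Then $\langle T(\to s),T'(\to t)\rangle\in\mathbb P\times_{\mathsf E_0}\mathbb P$.
   Context: For $s,t\in 2^{<\omega}$ with $\mathrm{lh}(s)\le\mathrm{lh}(t)$, $s\cdot t$ has length $\mathrm{lh}(t)$ with $(s\cdot t)(k)=t(k)+s(k)\bmod2$ for $k<\mathrm{lh}(s)$, $=t(k)$ otherwise; if $\mathrm{lh}(s)>\mathrm{lh}(t)$, $s\cdot t=(s{\restriction}\mathrm{lh}(t))\cdot t$; $s\cdot T=\{s\cdot t:t\in T\}$; $T{\restriction}s=\{t\in T:s\subseteq t\lor t\subseteq s\}$. The stem of a perfect tree $T$ is the largest $s\in T$ with $T=T{\restriction}s$. $\mathbf{LT}$ is the set of perfect trees $T\subseteq2^{<\omega}$ for which there are nonempty strings $q^m_i$ ($m<\omega,i<2$) with $\mathrm{lh}(q^m_0)=\mathrm{lh}(q^m_1)$, $q^m_i(0)=i$, such that $T$ consists of all initial segments of strings $\mathrm{stem}(T)^\frown q^0_{i(0)}{}^\frown\cdots{}^\frown q^m_{i(m)}$. For $T\in\mathbf{LT}$: $T(\to i)=T{\restriction}(\mathrm{stem}(T)^\frown i)$, $T(\to\Lambda)=T$, and for $s\in2^m$, $T(\to s)=(\cdots(T(\to s(0)))\cdots)(\to s(m-1))$. A large-tree forcing notion is a set $\mathbb P\subseteq\mathbf{LT}$ closed under $T\mapsto T{\restriction}u$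 ($u\in T$) and $T\mapsto s\cdot T$ ($s\in2^{<\omega}$). $\mathbb P\times_{\mathsf E_0}\mathbb P$ is the set of pairs $\langle T,T'\rangle$ of trees in $\mathbb P$ such that $T'=\sigma\cdot T$ for some $\sigma\in2^{<\omega}$. -}

module Defs where

open import Data.Bool using (Bool; true; false; _xor_)
open import Data.List using (List; []; _∷_; _++_; length)
open import Data.Nat using (ℕ; zero; suc)
open import Level using (Lift; lift; 0ℓ) renaming (suc to lsuc)
open import Data.Product using (Σ; ∃; _×_; _,_)
open import Data.Sum using (_⊎_)
open import Relation.Binary.PropositionalEquality using (_≡_)
open import Relation.Nullary using (¬_)

Str : Set
Str = List Bool

-- A subset of 2^{<ω} (a tree is such a set)
Tree : Set₁
Tree = Str → Set

_⊑_ : Str → Str → Set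
s ⊑ t = ∃ λ r → s ++ r ≡ t

_≐_ : Tree → Tree → Set
T ≐ T' = ∀ u → (T u → T' u) × (T' u → T u)

-- s · t  (bitwise sum on the common part, length lh(t))
_·_ : Str → Str → Str
[] · t = t
(a ∷ s) · [] = []
(a ∷ s) · (b ∷ t) = (b xor a) ∷ (s · t)

_·T_ : Str → Tree → Tree
(s ·T T) u = ∃ λ t → T t × u ≡ s · t

_↾_ : Tree → Str → Tree
(T ↾ s) t = T t × (s ⊑ t ⊎ t ⊑ s)

IsPerfectTree : Tree → Set
IsPerfectTree T =
  (∃ λ u → T u)
  × (∀ u v → T v → u ⊑ v → T u)
  × (∀ u → T u → ∃ λ v → ∃ λ w → T v × T w × u ⊑ v × u ⊑ w × ¬ (v ⊑ w) × ¬ (w ⊑ v))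

IsStem : Tree → Str → Set
IsStem T s = T s × (T ≐ (T ↾ s)) × (∀ s' → T s' → T ≐ (T ↾ s') → s' ⊑ s)

blocks : Str → (ℕ → Bool → Str) → (ℕ → Bool) → ℕ → Str
blocks s q i zero = s
blocks s q i (suc m) = blocks s q i m ++ q m (i m)

IsLT : Tree → Set
IsLT T =
  IsPerfectTree T ×
  Σ Str λ s → IsStem T s ×
  Σ (ℕ → Bool → Str) λ q →
    (∀ m b → Σ Str λ r → q m b ≡ b ∷ r)
    × (∀ m → length (q m false) ≡ length (q m true))
    × (∀ u → T u ⇔' (∃ λ m → ∃ λ (i : ℕ → Bool) → u ⊑ blocks s q i (suc m)))
  where
  _⇔'_ : Set → Set → Set
  A ⇔' B = (A → B) × (B → A)

-- R = T(→ i)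
Succ1 : Tree → Bool → Tree → Set
Succ1 T i R = ∃ λ s → IsStem T s × (R ≐ (T ↾ (s ++ (i ∷ []))))

-- R = T(→ s)
SuccN : Tree → Str → Tree → Set₁
SuccN T [] R = Lift (lsuc 0ℓ) (R ≐ T)
SuccN T (b ∷ s) R = ∃ λ R₁ → Succ1 T b R₁ × SuccN R₁ s R

-- membership in the set P (sets are extensional)
_∈P_ : Tree → (Tree → Set) → Set₁
X ∈P P = ∃ λ T₀ → P T₀ × (T₀ ≐ X)

IsLargeTreeForcing : (Tree → Set) → Set₁
IsLargeTreeForcing P =
  (∀ T → P T → IsLT T)
  × (∀ T u → P T → T u → (T ↾ u) ∈P P)
  × (∀ T s → P T → (s ·T T) ∈P P)

InProdE0 : (Tree → Set) → Tree → Tree → Set₁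
InProdE0 P T T' = T ∈P P × T' ∈P P × ∃ λ σ → T' ≐ (σ ·T T)

module Submission where

-- A large tree T with stem a and splitting blocks q is
-- "described" by (a , q): its nodes are the initial segments of the strings
-- a ⁀ q 0 (i 0) ⁀ … ⁀ q m (i m).  For such a tree the stem is forced to be a,
-- so T(→ b) = T ↾ (a ⁀ b) is described by (a ⁀ q 0 b , q ∘ suc); iterating,
-- T(→ l) is described by a stem whose length depends only on length l, with
-- the blocks q shifted by length l.  Two trees described by the same blocks
-- and stems of equal length are translates of each other (homogeneity).

open import Defs
open import Data.Bool using (Bool; true; false; _xor_; not)
open import Data.Bool.Properties using (xor-assoc; xor-comm; xor-same; xor-identityʳ; not-¬)
open import Data.Nat using (ℕ; zero; suc; _+_)
open import Data.Nat.Properties using (suc-injective)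
open import Data.Vec using (Vec; toList)
open import Data.Vec.Properties using (length-toList)
open import Data.List using ([]; _∷_; _++_; length)
open import Data.List.Properties using (++-assoc; ++-identityʳ; ∷-injectiveˡ; ∷-injectiveʳ; length-++)
open import Data.Product using (Σ; ∃; _×_; _,_; proj₁; proj₂)
open import Data.Sum using (_⊎_; inj₁; inj₂)
open import Data.Empty using (⊥-elim)
open import Level using (lift)
open import Function using (_∘_)
open import Relation.Binary.PropositionalEquality

-- The translation action of strings on strings

-- Adding the same bit twice cancels; this makes each translation involutive.
xor-cancelʳ : ∀ b a → (b xor a) xor a ≡ b
xor-cancelʳ b a = begin
  (b xor a) xor a  ≡⟨ xor-assoc b a a ⟩
  b xor (a xor a)  ≡⟨ cong (b xor_) (xor-same a) ⟩
  b xor false      ≡⟨ xor-identityʳ b ⟩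
  b                ∎
  where open ≡-Reasoning

·-length : ∀ σ t → length (σ · t) ≡ length t
·-length []      t       = refl
·-length (a ∷ σ) []      = refl
·-length (a ∷ σ) (b ∷ t) = cong suc (·-length σ t)

·-[] : ∀ σ → σ · [] ≡ []
·-[] []      = refl
·-[] (a ∷ σ) = refl

·-involutive : ∀ σ t → σ · (σ · t) ≡ t
·-involutive []      t       = refl
·-involutive (a ∷ σ) []      = refl
·-involutive (a ∷ σ) (b ∷ t) = cong₂ _∷_ (xor-cancelʳ b a) (·-involutive σ t)

·-++ : ∀ τ A W → length τ ≡ length A → τ · (A ++ W) ≡ (τ · A) ++ W
·-++ []      A       W _ = refl
·-++ (a ∷ τ) []      W ()
·-++ (a ∷ τ) (b ∷ A) W e = cong ((b xor a) ∷_) (·-++ τ A W (suc-injective e))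

·-difference : ∀ A A' → length A ≡ length A' → (A · A') · A ≡ A'
·-difference []      []        _ = refl
·-difference []      (_ ∷ _)   ()
·-difference (_ ∷ _) []        ()
·-difference (a ∷ A) (a' ∷ A') e =
  cong₂ _∷_ (trans (xor-comm a (a' xor a)) (xor-cancelʳ a' a)) (·-difference A A' (suc-injective e))

·-snoc : ∀ σ s b → ∃ λ b' → σ · (s ++ b ∷ []) ≡ (σ · s) ++ b' ∷ []
·-snoc []      s       b = b , refl
·-snoc (a ∷ σ) []      b = b xor a , cong ((b xor a) ∷_) (·-[] σ)
·-snoc (a ∷ σ) (c ∷ s) b with ·-snoc σ s b
... | b' , e = b' , cong ((c xor a) ∷_) e

compose : Str → Str → Str
compose []      τ       = τ
compose (a ∷ σ) []      = a ∷ σ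
compose (a ∷ σ) (b ∷ τ) = (b xor a) ∷ compose σ τ

compose-· : ∀ σ τ x → compose σ τ · x ≡ σ · (τ · x)
compose-· []      τ       x       = refl
compose-· (a ∷ σ) []      x       = refl
compose-· (a ∷ σ) (b ∷ τ) []      = refl
compose-· (a ∷ σ) (b ∷ τ) (c ∷ x) = cong₂ _∷_ (sym (xor-assoc c b a)) (compose-· σ τ x)

⊑-refl : ∀ x → x ⊑ x
⊑-refl x = [] , ++-identityʳ x

⊑-trans : ∀ {x y z} → x ⊑ y → y ⊑ z → x ⊑ z
⊑-trans {x} (r , refl) (r' , refl) = r ++ r' , sym (++-assoc x r r')

⊑-++ : ∀ x y → x ⊑ (x ++ y)
⊑-++ x y = y , refl

⊑-translate : ∀ σ {t x} → t ⊑ x → (σ · t) ⊑ (σ · x)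
⊑-translate σ {t} (r , refl) = go σ t r
  where
  go : ∀ σ t r → (σ · t) ⊑ (σ · (t ++ r))
  go []      t       r = r , refl
  go (a ∷ σ) []      r = (a ∷ σ) · r , refl
  go (a ∷ σ) (b ∷ t) r with go σ t r
  ... | r' , e = r' , cong ((b xor a) ∷_) e

Comparable : Str → Str → Set
Comparable u v = u ⊑ v ⊎ v ⊑ u

comparable-sym : ∀ {u v} → Comparable u v → Comparable v u
comparable-sym (inj₁ p) = inj₂ p
comparable-sym (inj₂ p) = inj₁ p

comparable-translate : ∀ σ {x y} → Comparable x y → Comparable (σ · x) (σ · y)
comparable-translate σ (inj₁ p) = inj₁ (⊑-translate σ p)
comparable-translate σ (inj₂ p) = inj₂ (⊑-translate σ p)

comparable-untranslate : ∀ σ {x y} → Comparable (σ · x) (σ · y) → Comparable x y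
comparable-untranslate σ {x} {y} c =
  subst₂ Comparable (·-involutive σ x) (·-involutive σ y) (comparable-translate σ c)

⊑-common : ∀ {u v w} → u ⊑ w → v ⊑ w → Comparable u v
⊑-common {u} {v} (r , p) (r' , p') = go u v (trans p (sym p'))
  where
  go : ∀ u v {r r'} → u ++ r ≡ v ++ r' → Comparable u v
  go []      v       e = inj₁ (v , refl)
  go (x ∷ u) []      e = inj₂ (x ∷ u , refl)
  go (x ∷ u) (y ∷ v) e with ∷-injectiveˡ e | go u v (∷-injectiveʳ e)
  ... | refl | inj₁ (w , q) = inj₁ (w , cong (x ∷_) q)
  ... | refl | inj₂ (w , q) = inj₂ (w , cong (x ∷_) q)

comparable-branch : ∀ a x y z w → Comparable (a ++ x ∷ y) (a ++ z ∷ w) → x ≡ z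
comparable-branch []      x y z w (inj₁ (r , e)) = ∷-injectiveˡ e
comparable-branch []      x y z w (inj₂ (r , e)) = sym (∷-injectiveˡ e)
comparable-branch (c ∷ a) x y z w (inj₁ (r , e)) = comparable-branch a x y z w (inj₁ (r , ∷-injectiveʳ e))
comparable-branch (c ∷ a) x y z w (inj₂ (r , e)) = comparable-branch a x y z w (inj₂ (r , ∷-injectiveʳ e))

≐-sym : ∀ {X Y} → X ≐ Y → Y ≐ X
≐-sym e u = proj₂ (e u) , proj₁ (e u)

≐-trans : ∀ {X Y Z} → X ≐ Y → Y ≐ Z → X ≐ Z
≐-trans e f u = (proj₁ (f u) ∘ proj₁ (e u)) , (proj₂ (e u) ∘ proj₂ (f u))

↾-cong : ∀ {X Y} u → X ≐ Y → (X ↾ u) ≐ (Y ↾ u)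
↾-cong u e w = (λ (x , c) → proj₁ (e w) x , c) , (λ (y , c) → proj₂ (e w) y , c)

·T-cong : ∀ σ {X Y} → X ≐ Y → (σ ·T X) ≐ (σ ·T Y)
·T-cong σ e w = (λ (t , x , p) → t , proj₁ (e t) x , p) , (λ (t , y , p) → t , proj₂ (e t) y , p)

·T-↾ : ∀ σ X u → (σ ·T (X ↾ u)) ≐ ((σ ·T X) ↾ (σ · u))
·T-↾ σ X u w =
  (λ { (t , (x , c) , refl) → (t , x , refl) , comparable-translate σ c }) ,
  (λ { ((t , x , refl) , c) → t , (x , comparable-untranslate σ c) , refl })

·T-compose : ∀ τ σ X → (compose τ σ ·T X) ≐ (τ ·T (σ ·T X))
·T-compose τ σ X w =
  (λ { (t , x , refl) → σ · t , (t , x , refl) , compose-· τ σ t }) ,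
  (λ { (_ , (t , x , refl) , refl) → t , x , sym (compose-· τ σ t) })

stem-cong : ∀ {X Y s} → X ≐ Y → IsStem X s → IsStem Y s
stem-cong {s = s} E (Xs , X≐X↾s , maximal) =
  proj₁ (E s) Xs ,
  ≐-trans (≐-sym E) (≐-trans X≐X↾s (↾-cong s E)) ,
  λ s' Ys' Y≐Y↾s' → maximal s' (proj₂ (E s') Ys') (≐-trans E (≐-trans Y≐Y↾s' (↾-cong s' (≐-sym E))))

succN-cong : ∀ {X Y R} l → X ≐ Y → SuccN X l R → SuccN Y l R
succN-cong []      E (lift R≐X)                    = lift (≐-trans R≐X E)
succN-cong (b ∷ l) E (R₁ , (s , st , R₁≐) , rest) =
  R₁ , (s , stem-cong E st , ≐-trans R₁≐ (↾-cong _ E)) , rest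

stem-translate : ∀ σ {X s} → IsStem X s → IsStem (σ ·T X) (σ · s)
stem-translate σ {X} {s} (Xs , X≐X↾s , maximal) =
  (s , Xs , refl) , ≐-trans (·T-cong σ X≐X↾s) (·T-↾ σ X s) , maximal'
  where
  maximal' : ∀ s' → (σ ·T X) s' → (σ ·T X) ≐ ((σ ·T X) ↾ s') → s' ⊑ (σ · s)
  maximal' _ (t , Xt , refl) E = ⊑-translate σ (maximal t Xt X≐X↾t)
    where
    X≐X↾t : X ≐ (X ↾ t)
    X≐X↾t u = (λ Xu → Xu , comparable-untranslate σ (proj₂ (proj₁ (E (σ · u)) (u , Xu , refl)))) , proj₁

succ1-translate : ∀ σ {X b R} → Succ1 X b R → ∃ λ b' → Succ1 (σ ·T X) b' (σ ·T R)
succ1-translate σ {X} {b} {R} (s , st , R≐) with ·-snoc σ s b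
... | b' , eq = b' , σ · s , stem-translate σ st ,
  subst (λ w → (σ ·T R) ≐ ((σ ·T X) ↾ w)) eq (≐-trans (·T-cong σ R≐) (·T-↾ σ X (s ++ b ∷ [])))

succN-translate : ∀ σ {X R} l → SuccN X l R →
  Σ Str λ l' → length l' ≡ length l × SuccN (σ ·T X) l' (σ ·T R)
succN-translate σ []      (lift R≐X)        = [] , refl , lift (·T-cong σ R≐X)
succN-translate σ (b ∷ l) (R₁ , first , rest) with succ1-translate σ first | succN-translate σ l rest
... | b' , first' | l' , len , rest' = b' ∷ l' , cong suc len , (σ ·T R₁ , first' , rest')

-- Descriptions of large trees

Below : Str → (ℕ → Bool → Str) → Str → Set
Below a q u = ∃ λ m → ∃ λ (i : ℕ → Bool) → u ⊑ blocks a q i (suc m)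

-- X is the large tree with trunk a and splitting blocks q.
record Desc (X : Tree) (a : Str) (q : ℕ → Bool → Str) : Set where
  field
    heads : ∀ m b → Σ Str λ r → q m b ≡ b ∷ r
    lens  : ∀ m → length (q m false) ≡ length (q m true)
    to    : ∀ u → X u → Below a q u
    from  : ∀ u → Below a q u → X u
open Desc

desc-cong : ∀ {X Y a q} → X ≐ Y → Desc X a q → Desc Y a q
desc-cong E d = record
  { heads = heads d ; lens = lens d
  ; to = λ u → to d u ∘ proj₂ (E u) ; from = λ u → proj₁ (E u) ∘ from d u }

desc-unique : ∀ {X Y a q} → Desc X a q → Desc Y a q → X ≐ Y
desc-unique dX dY u = from dY u ∘ to dX u , from dX u ∘ to dY u

UniformBlocks : (ℕ → Bool → Str) → Set
UniformBlocks q = ∀ m b b' → length (q m b) ≡ length (q m b')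

desc-uniform : ∀ {X a q} → Desc X a q → UniformBlocks q
desc-uniform d m false false = refl
desc-uniform d m false true  = lens d m
desc-uniform d m true  false = sym (lens d m)
desc-uniform d m true  true  = refl

blocks-prefix : ∀ a q i k → a ⊑ blocks a q i k
blocks-prefix a q i zero    = ⊑-refl a
blocks-prefix a q i (suc k) = ⊑-trans (blocks-prefix a q i k) (⊑-++ _ _)

blocks-monotone : ∀ a q i m → blocks a q i 1 ⊑ blocks a q i (suc m)
blocks-monotone a q i zero    = ⊑-refl _
blocks-monotone a q i (suc m) = ⊑-trans (blocks-monotone a q i m) (⊑-++ _ _)

blocks-shift : ∀ a q i k → blocks (a ++ q 0 (i 0)) (q ∘ suc) (i ∘ suc) k ≡ blocks a q i (suc k)
blocks-shift a q i zero    = refl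
blocks-shift a q i (suc k) = cong (_++ q (suc k) (i (suc k))) (blocks-shift a q i k)

blocks-split : ∀ a q i k → blocks a q i k ≡ a ++ blocks [] q i k
blocks-split a q i zero    = sym (++-identityʳ a)
blocks-split a q i (suc k) =
  trans (cong (_++ q k (i k)) (blocks-split a q i k)) (++-assoc a (blocks [] q i k) (q k (i k)))

blocks-translate : ∀ τ a q i k → length τ ≡ length a → τ · blocks a q i k ≡ blocks (τ · a) q i k
blocks-translate τ a q i k len = begin
  τ · blocks a q i k             ≡⟨ cong (τ ·_) (blocks-split a q i k) ⟩
  τ · (a ++ blocks [] q i k)     ≡⟨ ·-++ τ a _ len ⟩
  (τ · a) ++ blocks [] q i k     ≡⟨ sym (blocks-split (τ · a) q i k) ⟩
  blocks (τ · a) q i k           ∎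
  where open ≡-Reasoning

trunk-bit⊑block : ∀ {X a q} → Desc X a q → ∀ b → (a ++ b ∷ []) ⊑ (a ++ q 0 b)
trunk-bit⊑block {a = a} d b with heads d 0 b
... | r , h rewrite h = r , ++-assoc a (b ∷ []) r

desc-root : ∀ {X a q} → Desc X a q → X a
desc-root {a = a} {q} d = from d a (0 , (λ _ → false) , ⊑-++ a (q 0 false))

desc-node : ∀ {X a q} → Desc X a q → ∀ b → X (a ++ q 0 b)
desc-node {a = a} {q} d b = from d _ (0 , (λ _ → b) , ⊑-refl (a ++ q 0 b))

desc-trunk : ∀ {X a q} → Desc X a q → X ≐ (X ↾ a)
desc-trunk {a = a} {q} d u = (λ Xu → Xu , comparable u (to d u Xu)) , proj₁
  where
  comparable : ∀ u → Below a q u → Comparable a u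
  comparable u (m , i , p) = ⊑-common (blocks-prefix a q i (suc m)) p

-- The stem of a described tree is its trunk: the stem extends a, and cannot
-- extend it by a bit c since a ⁀ q 0 (not c) is also in the tree.
desc-stem : ∀ {X a q s} → Desc X a q → IsStem X s → s ≡ a
desc-stem {a = a} {q} d (_ , X≐X↾s , maximal)
  with maximal a (desc-root d) (desc-trunk d)
... | []     , e = trans (sym e) (++-identityʳ a)
... | c ∷ r' , e = ⊥-elim (not-¬ refl (sym (comparable-branch a (not c) r c r' branches)))
  where
  r = proj₁ (heads d 0 (not c))
  branches : Comparable (a ++ not c ∷ r) (a ++ c ∷ r')
  branches = subst₂ Comparable (cong (a ++_) (proj₂ (heads d 0 (not c)))) (sym e)
    (comparable-sym (proj₂ (proj₁ (X≐X↾s _) (desc-node d (not c)))))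

cons : Bool → (ℕ → Bool) → ℕ → Bool
cons b i zero    = b
cons b i (suc n) = i n

desc-restrict : ∀ {X a q} → Desc X a q → ∀ b → Desc (X ↾ (a ++ b ∷ [])) (a ++ q 0 b) (q ∘ suc)
desc-restrict {X} {a} {q} d b = record
  { heads = heads d ∘ suc ; lens = lens d ∘ suc ; to = to' ; from = from' }
  where
  from' : ∀ u → Below (a ++ q 0 b) (q ∘ suc) u → (X ↾ (a ++ b ∷ [])) u
  from' u (m , i , p) =
    from d u (suc m , cons b i , subst (u ⊑_) (blocks-shift a q (cons b i) (suc m)) p) ,
    ⊑-common (⊑-trans (trunk-bit⊑block d b) (blocks-prefix (a ++ q 0 b) (q ∘ suc) i (suc m))) p
  to' : ∀ u → (X ↾ (a ++ b ∷ [])) u → Below (a ++ q 0 b) (q ∘ suc) u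
  to' u (Xu , c) with to d u Xu | c
  ... | m , i , p | inj₂ u⊑ab = 0 , i , ⊑-trans u⊑ab
          (⊑-trans (trunk-bit⊑block d b) (blocks-prefix _ (q ∘ suc) i 1))
  ... | m , i , p | inj₁ ab⊑u = m , i ∘ suc ,
          subst (λ z → u ⊑ blocks (a ++ q 0 z) (q ∘ suc) (i ∘ suc) (suc m)) (sym b≡i0)
            (subst (u ⊑_) (sym (blocks-shift a q i (suc m))) (⊑-trans p (⊑-++ _ _)))
    where
    b≡i0 : b ≡ i 0
    b≡i0 = comparable-branch a b [] (i 0) _
      (subst (λ z → Comparable (a ++ b ∷ []) (a ++ z)) (proj₂ (heads d 0 (i 0)))
        (⊑-common (⊑-trans ab⊑u p) (blocks-monotone a q i m)))

succTrunk : Str → (ℕ → Bool → Str) → Str → Str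
succTrunk a q []      = a
succTrunk a q (b ∷ l) = succTrunk (a ++ q 0 b) (q ∘ suc) l

dropBlocks : ℕ → (ℕ → Bool → Str) → (ℕ → Bool → Str)
dropBlocks zero    q = q
dropBlocks (suc n) q = dropBlocks n (q ∘ suc)

desc-successors : ∀ {X a q R} l → Desc X a q → SuccN X l R →
  Desc R (succTrunk a q l) (dropBlocks (length l) q)
desc-successors []      d (lift R≐X) = desc-cong (≐-sym R≐X) d
desc-successors (b ∷ l) d (R₁ , (s , st , R₁≐) , rest) with desc-stem d st
... | refl = desc-successors l (desc-cong (≐-sym R₁≐) (desc-restrict d b)) rest

succTrunk-length : ∀ {q} → UniformBlocks q → ∀ a a' l l' →
  length a ≡ length a' → length l ≡ length l' → length (succTrunk a q l) ≡ length (succTrunk a' q l')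
succTrunk-length         u a a' []      []        ea el = ea
succTrunk-length {q = q} u a a' (b ∷ l) (b' ∷ l') ea el =
  succTrunk-length (u ∘ suc) (a ++ q 0 b) (a' ++ q 0 b') l l' trunks (suc-injective el)
  where
  open ≡-Reasoning
  trunks : length (a ++ q 0 b) ≡ length (a' ++ q 0 b')
  trunks = begin
    length (a ++ q 0 b)             ≡⟨ length-++ a ⟩
    length a + length (q 0 b)       ≡⟨ cong₂ _+_ ea (u 0 b b') ⟩
    length a' + length (q 0 b')     ≡⟨ sym (length-++ a') ⟩
    length (a' ++ q 0 b')           ∎

desc-translate : ∀ {R A q} τ → Desc R A q → length τ ≡ length A → Desc (τ ·T R) (τ · A) q
desc-translate {R} {A} {q} τ d len = record
  { heads = heads d ; lens = lens d ; to = to' ; from = from' }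
  where
  to' : ∀ u → (τ ·T R) u → Below (τ · A) q u
  to' _ (t , Rt , refl) with to d t Rt
  ... | m , i , p = m , i , subst ((τ · t) ⊑_) (blocks-translate τ A q i (suc m) len) (⊑-translate τ p)
  from' : ∀ u → Below (τ · A) q u → (τ ·T R) u
  from' u (m , i , p) = τ · u , from d (τ · u) (m , i , τu⊑) , sym (·-involutive τ u)
    where
    τu⊑ : (τ · u) ⊑ blocks A q i (suc m)
    τu⊑ = subst ((τ · u) ⊑_)
      (trans (blocks-translate τ (τ · A) q i (suc m) (trans len (sym (·-length τ A))))
             (cong (λ z → blocks z q i (suc m)) (·-involutive τ A)))
      (⊑-translate τ p)

-- Homogeneity: trees described by the same blocks and trunks of equal length
-- are translates of each other, by the difference of the trunks.
homogeneity : ∀ {R R' A A' q} → Desc R A q → Desc R' A' q → length A ≡ length A' →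
  ∃ λ τ → R' ≐ (τ ·T R)
homogeneity {R} {A = A} {A'} {q} dR dR' len = A · A' ,
  desc-unique dR' (subst (λ z → Desc ((A · A') ·T R) z q) (·-difference A A' len)
    (desc-translate (A · A') dR (trans (·-length A A') (sym len))))

∈P-cong : ∀ {P X Y} → X ∈P P → X ≐ Y → Y ∈P P
∈P-cong (T₀ , PT₀ , T₀≐X) X≐Y = T₀ , PT₀ , ≐-trans T₀≐X X≐Y

desc-member : ∀ {P X} → IsLargeTreeForcing P → X ∈P P →
  Σ Str λ a → Σ (ℕ → Bool → Str) λ q → Desc X a q
desc-member (allLT , _ , _) (T₀ , PT₀ , T₀≐X) with allLT T₀ PT₀
... | _ , a , _ , q , hd , ln , iff = a , q ,
  desc-cong T₀≐X (record { heads = hd ; lens = ln ; to = proj₁ ∘ iff ; from = proj₂ ∘ iff })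

restrict-member : ∀ {P X u} → IsLargeTreeForcing P → X ∈P P → X u → (X ↾ u) ∈P P
restrict-member {u = u} (_ , restrict , _) (T₀ , PT₀ , T₀≐X) Xu =
  ∈P-cong (restrict T₀ u PT₀ (proj₂ (T₀≐X u) Xu)) (↾-cong u T₀≐X)

-- X(→ b) = X ↾ (a ⁀ b), where the trunk a is the stem and a ⁀ b is a node.
successor-member : ∀ {P X b R} → IsLargeTreeForcing P → X ∈P P → Succ1 X b R → R ∈P P
successor-member {X = X} {b} F XP (s , st , R≐) with desc-member F XP
... | a , q , d with desc-stem d st
... | refl = ∈P-cong (restrict-member F XP Xab) (≐-sym R≐)
  where
  Xab : X (a ++ b ∷ [])
  Xab = from d _ (0 , (λ _ → b) , trunk-bit⊑block d b)

successors-member : ∀ {P X R} → IsLargeTreeForcing P → X ∈P P → ∀ l → SuccN X l R → R ∈P P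
successors-member F XP []      (lift R≐X)        = ∈P-cong XP (≐-sym R≐X)
successors-member F XP (b ∷ l) (R₁ , first , rest) =
  successors-member F (successor-member F XP first) l rest

-- Successors of E₀-related trees along strings of equal length are translates:
-- σ · T(→ l) is a successor of σ · T ≐ T' along a string as long as l, so it
-- and T'(→ l') are described by the same blocks of T', with equally long trunks.
successors-translates : ∀ {T T' R R' σ a q} l l' → Desc T' a q → T' ≐ (σ ·T T) →
  SuccN T l R → SuccN T' l' R' → length l ≡ length l' → ∃ λ ρ → R' ≐ (ρ ·T R)
successors-translates {R = R} {R'} {σ} {a} {q} l l' d T'≐σT succ succ' len
  with succN-translate σ l succ
... | l₁ , len₁ , σsucc with homogeneity dσR dR' trunks
  where
  same-length : length l₁ ≡ length l'
  same-length = trans len₁ len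
  dσR : Desc (σ ·T R) (succTrunk a q l₁) (dropBlocks (length l') q)
  dσR = subst (λ k → Desc (σ ·T R) (succTrunk a q l₁) (dropBlocks k q)) same-length
    (desc-successors l₁ d (succN-cong l₁ (≐-sym T'≐σT) σsucc))
  dR' : Desc R' (succTrunk a q l') (dropBlocks (length l') q)
  dR' = desc-successors l' d succ'
  trunks : length (succTrunk a q l₁) ≡ length (succTrunk a q l')
  trunks = succTrunk-length (desc-uniform d) a a l₁ l' refl same-length
... | τ , R'≐τσR = compose τ σ , ≐-trans R'≐τσR (≐-sym (·T-compose τ σ R))

lemma5p3 : (P : Tree → Set) → IsLargeTreeForcing P →
    (T T' : Tree) → InProdE0 P T T' →
    (n : ℕ) (s t : Vec Bool n) (R R' : Tree) →
    SuccN T (toList s) R → SuccN T' (toList t) R' →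
    InProdE0 P R R'
lemma5p3 P F T T' (TP , T'P , σ , T'≐σT) n s t R R' succ succ' =
  successors-member F TP (toList s) succ ,
  successors-member F T'P (toList t) succ' ,
  successors-translates (toList s) (toList t) (proj₂ (proj₂ (desc-member F T'P))) T'≐σT succ succ'
    (trans (length-toList s) (sym (length-toList t)))
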